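{- Let $s$ and $q$ be positive integers with $s = \frac{q-1}{2}$ and $s \equiv 3 \pmod 4$. If there exists a skew Hadamard matrix of order $s+1$ and there exists a conference matrix of order $q$, then there exists a Hadamard matrix of order $2q(s+1)$.
   Context: A Hadamard matrix of order $n$ is an $n\times n$ matrix $H$ with entries in $\{ -1,1\}$ such that $HH^T = H^TH = nI_n$. A skew Hadamard matrix is a Hadamard matrix $H$ of the form $H = S + I$ with $S$ skew-symmetric ($S^T=-S$). Write $J_q$ for the $q\times q$ all-ones matrix. In this paper a conference matrix of order $q$ means a $q\times q$ matrix $C_q$ with zero diagonal, entries $\pm 1$ off the diagonal, satisfying $C_qC_q^T = qI_q - J_q$ and $C_qJ_q = J_qC_q = 0$ (for example, for a prime power $q$, the matrix $C_q=[\chi(\alpha_j-\alpha_i)]_{i,j}$ where $\chi$ is the quadratic character of $GF(q)=\{\alpha_1,\dots,\alpha_q\}$ with $\chi(0)=0$). -}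

module Defs where

open import Data.Nat using (ℕ; zero; suc)
open import Data.Fin using (Fin; zero; suc)
open import Data.Integer using (ℤ; +_; -_; _+_; _-_; _*_; 1ℤ; 0ℤ; -1ℤ)
open import Data.Sum using (_⊎_)
open import Data.Product using (_×_)
open import Relation.Binary.PropositionalEquality using (_≡_; _≢_)

Matrix : ℕ → Set
Matrix n = Fin n → Fin n → ℤ

sumFin : ∀ {n} → (Fin n → ℤ) → ℤ
sumFin {zero}  f = 0ℤ
sumFin {suc n} f = f zero + sumFin (λ k → f (suc k))

_·_ : ∀ {n} → Matrix n → Matrix n → Matrix n
(A · B) i j = sumFin (λ k → A i k * B k j)

transpose : ∀ {n} → Matrix n → Matrix n
transpose A i j = A j i

δ : ∀ {n} → Fin n → Fin n → ℤ
δ zero    zero    = 1ℤ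
δ zero    (suc j) = 0ℤ
δ (suc i) zero    = 0ℤ
δ (suc i) (suc j) = δ i j

I : ∀ n → Matrix n
I n = δ

J : ∀ n → Matrix n
J n _ _ = 1ℤ

scalarI : ∀ n → ℤ → Matrix n
scalarI n c i j = c * δ i j

PM1 : ℤ → Set
PM1 x = (x ≡ 1ℤ) ⊎ (x ≡ -1ℤ)

IsHadamard : ∀ n → Matrix n → Set
IsHadamard n H =
  (∀ i j → PM1 (H i j)) ×
  (∀ i j → (H · transpose H) i j ≡ scalarI n (+ n) i j) ×
  (∀ i j → (transpose H · H) i j ≡ scalarI n (+ n) i j)

IsSkewSymmetric : ∀ {n} → Matrix n → Set
IsSkewSymmetric S = ∀ i j → S j i ≡ - S i j

IsSkewHadamard : ∀ n → Matrix n → Set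
IsSkewHadamard n H =
  IsHadamard n H × IsSkewSymmetric (λ i j → H i j - δ i j)

IsConference : ∀ q → Matrix q → Set
IsConference q C =
  (∀ i → C i i ≡ 0ℤ) ×
  (∀ i j → i ≢ j → PM1 (C i j)) ×
  (∀ i j → (C · transpose C) i j ≡ scalarI q (+ q) i j - J q i j) ×
  (∀ i j → (C · J q) i j ≡ 0ℤ) ×
  (∀ i j → (J q · C) i j ≡ 0ℤ)

-- Since q ≡ 3 (mod 4), the conference matrix C is skew-symmetric: for i ≠ j,
-- Σₖ (1 + Cᵢₖ)(1 + Cⱼₖ) = q − 1, and every term with k ∉ {i, j} is 0 or 4, so
-- Cᵢⱼ + Cⱼᵢ ≡ q − 3 ≡ 0 (mod 4), which for signs means Cⱼᵢ = −Cᵢⱼ.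
-- Bordering C gives a skew Z of order q + 1 with Z Zᵀ = q I, and then
-- H = J ⊗ I + (I + C) ⊗ Z has ±1 entries and
-- H Hᵀ = q J ⊗ I + J ⊗ (Z + Zᵀ) + ((q + 1) I − J) ⊗ q I = q (q + 1) I;
-- Hᵀ is the same construction applied to Cᵀ and Zᵀ, so Hᵀ H = q (q + 1) I too.

module Submission where

open import Defs

module _ where

  open import Data.Nat as ℕ using (ℕ; zero; suc; _%_; _/_)
  open import Data.Nat.DivMod using (m≡m%n+[m/n]*n)
  import Data.Nat.Divisibility as ℕ
  open import Data.Fin using (Fin; zero; suc; _↑ˡ_; _↑ʳ_; combine; quotient; remainder)
  open import Data.Fin.Properties using (_≟_; remQuot-combine; combine-injective; combine-surjective)
  open import Data.Integer using (ℤ; +_; -_; _+_; _-_; _*_; 1ℤ; 0ℤ; -1ℤ)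
  open import Data.Integer.Properties
    using (+-assoc; +-identityˡ; +-identityʳ; *-identityˡ; *-identityʳ; *-zeroˡ; *-zeroʳ; *-comm;
           *-distribˡ-+; *-distribʳ-+; neg-involutive; pos-+; pos-*)
  open import Data.Integer.Divisibility.Signed using (_∣_; divides; ∣⇒∣ᵤ; ∣m∣n⇒∣m+n; ∣m∣n⇒∣m-n)
  open import Data.Integer.Tactic.RingSolver using (solve-∀)
  open import Data.Product using (_×_; _,_; proj₁; proj₂)
  open import Data.Sum using (inj₁; inj₂)
  open import Data.Empty using (⊥-elim)
  open import Relation.Nullary using (yes; no; ¬_)
  open import Relation.Binary.PropositionalEquality hiding (J)
  open ≡-Reasoning

  sumFin-cong : ∀ {n} {f g : Fin n → ℤ} → (∀ k → f k ≡ g k) → sumFin f ≡ sumFin g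
  sumFin-cong {zero}  f≗g = refl
  sumFin-cong {suc n} f≗g = cong₂ _+_ (f≗g zero) (sumFin-cong (λ k → f≗g (suc k)))

  sumFin-distrib-+ : ∀ {n} (f g : Fin n → ℤ) → sumFin (λ k → f k + g k) ≡ sumFin f + sumFin g
  sumFin-distrib-+ {zero}  f g = refl
  sumFin-distrib-+ {suc n} f g
    rewrite sumFin-distrib-+ (λ k → f (suc k)) (λ k → g (suc k)) = swap-middle (f zero) (g zero) _ _
    where
    swap-middle : ∀ a b c d → a + b + (c + d) ≡ a + c + (b + d)
    swap-middle = solve-∀

  sumFin-*ˡ : ∀ {n} (c : ℤ) (f : Fin n → ℤ) → sumFin (λ k → c * f k) ≡ c * sumFin f
  sumFin-*ˡ {zero}  c f = sym (*-zeroʳ c)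
  sumFin-*ˡ {suc n} c f rewrite sumFin-*ˡ c (λ k → f (suc k)) = sym (*-distribˡ-+ c (f zero) _)

  sumFin-*ʳ : ∀ {n} (f : Fin n → ℤ) (c : ℤ) → sumFin (λ k → f k * c) ≡ sumFin f * c
  sumFin-*ʳ f c = begin
    sumFin (λ k → f k * c) ≡⟨ sumFin-cong (λ k → *-comm (f k) c) ⟩
    sumFin (λ k → c * f k) ≡⟨ sumFin-*ˡ c f ⟩
    c * sumFin f           ≡⟨ *-comm c (sumFin f) ⟩
    sumFin f * c           ∎

  sumFin-const : ∀ n (c : ℤ) → sumFin {n} (λ _ → c) ≡ + n * c
  sumFin-const zero    c = sym (*-zeroˡ c)
  sumFin-const (suc n) c = begin
    c + sumFin {n} (λ _ → c) ≡⟨ cong (λ t → c + t) (sumFin-const n c) ⟩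
    c + + n * c              ≡⟨ succ-* (+ n) c ⟩
    (1ℤ + + n) * c           ≡⟨ cong (_* c) (sym (pos-+ 1 n)) ⟩
    + suc n * c              ∎
    where
    succ-* : ∀ m c → c + m * c ≡ (1ℤ + m) * c
    succ-* = solve-∀

  sumFin-congruent : ∀ {n} {d : ℤ} (f g : Fin n → ℤ) → (∀ k → d ∣ f k - g k) → d ∣ sumFin f - sumFin g
  sumFin-congruent {zero}  f g d∣f-g = divides 0ℤ refl
  sumFin-congruent {suc n} f g d∣f-g =
    subst (_ ∣_) (regroup (f zero) (g zero) _ _)
          (∣m∣n⇒∣m+n (d∣f-g zero) (sumFin-congruent (λ k → f (suc k)) (λ k → g (suc k)) (λ k → d∣f-g (suc k))))
    where
    regroup : ∀ a b c e → (a - b) + (c - e) ≡ (a + c) - (b + e)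
    regroup = solve-∀

  sumFin-++ : ∀ {m n} (f : Fin (m ℕ.+ n) → ℤ) →
    sumFin f ≡ sumFin (λ i → f (i ↑ˡ n)) + sumFin (λ j → f (m ↑ʳ j))
  sumFin-++ {zero}  f = sym (+-identityˡ _)
  sumFin-++ {suc m} {n} f rewrite sumFin-++ {m} {n} (λ k → f (suc k)) = sym (+-assoc (f zero) _ _)

  sumFin-combine : ∀ {m n} (f : Fin (m ℕ.* n) → ℤ) →
    sumFin f ≡ sumFin {m} (λ a → sumFin {n} (λ x → f (combine a x)))
  sumFin-combine {zero}      f = refl
  sumFin-combine {suc m} {n} f rewrite sumFin-++ {n} {m ℕ.* n} f =
    cong (λ t → sumFin (λ x → f (x ↑ˡ (m ℕ.* n))) + t) (sumFin-combine {m} {n} (λ k → f (n ↑ʳ k)))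

  δ-refl : ∀ {n} (i : Fin n) → δ i i ≡ 1ℤ
  δ-refl zero    = refl
  δ-refl (suc i) = δ-refl i

  δ-≢ : ∀ {n} {i j : Fin n} → i ≢ j → δ i j ≡ 0ℤ
  δ-≢ {i = zero}  {zero}  i≢j = ⊥-elim (i≢j refl)
  δ-≢ {i = zero}  {suc j} i≢j = refl
  δ-≢ {i = suc i} {zero}  i≢j = refl
  δ-≢ {i = suc i} {suc j} i≢j = δ-≢ (λ i≡j → i≢j (cong suc i≡j))

  δ-sym : ∀ {n} (i j : Fin n) → δ i j ≡ δ j i
  δ-sym zero    zero    = refl
  δ-sym zero    (suc j) = refl
  δ-sym (suc i) zero    = refl
  δ-sym (suc i) (suc j) = δ-sym i j

  sumFin-δˡ : ∀ {n} (i : Fin n) (f : Fin n → ℤ) → sumFin (λ k → δ i k * f k) ≡ f i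
  sumFin-δˡ {suc n} zero    f rewrite sumFin-const n 0ℤ | *-zeroʳ (+ n) | *-identityˡ (f zero) =
    +-identityʳ (f zero)
  sumFin-δˡ {suc n} (suc i) f = trans (+-identityˡ _) (sumFin-δˡ i (λ k → f (suc k)))

  δ-combine : ∀ {m n} (a b : Fin m) (x y : Fin n) → δ (combine a x) (combine b y) ≡ δ a b * δ x y
  δ-combine a b x y with a ≟ b | x ≟ y
  ... | yes refl | yes refl rewrite δ-refl a | δ-refl x = δ-refl (combine a x)
  ... | yes refl | no x≢y   rewrite δ-≢ x≢y | *-zeroʳ (δ a a) =
    δ-≢ (λ eq → x≢y (proj₂ (combine-injective a x a y eq)))
  ... | no a≢b   | _        rewrite δ-≢ a≢b = δ-≢ (λ eq → a≢b (proj₁ (combine-injective a x b y eq)))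

  infixl 6 _+ᴹ_
  _+ᴹ_ : ∀ {n} → Matrix n → Matrix n → Matrix n
  (A +ᴹ B) i j = A i j + B i j

  infixl 7 _⊗_
  _⊗_ : ∀ {m n} → Matrix m → Matrix n → Matrix (m ℕ.* n)
  _⊗_ {m} {n} A B k l =
    A (quotient n k) (quotient n l) * B (remainder {m} n k) (remainder {m} n l)

  ·-cong : ∀ {n} {A A′ B B′ : Matrix n} → (∀ i j → A i j ≡ A′ i j) → (∀ i j → B i j ≡ B′ i j) →
    ∀ i j → (A · B) i j ≡ (A′ · B′) i j
  ·-cong A≗A′ B≗B′ i j = sumFin-cong (λ k → cong₂ _*_ (A≗A′ i k) (B≗B′ k j))

  ·-distribʳ-+ᴹ : ∀ {n} (A B C : Matrix n) i j → ((A +ᴹ B) · C) i j ≡ (A · C) i j + (B · C) i j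
  ·-distribʳ-+ᴹ {n} A B C i j =
    trans (sumFin-cong (λ k → *-distribʳ-+ (C k j) (A i k) (B i k))) (sumFin-distrib-+ {n} _ _)

  ·-distribˡ-+ᴹ : ∀ {n} (A B C : Matrix n) i j → (A · (B +ᴹ C)) i j ≡ (A · B) i j + (A · C) i j
  ·-distribˡ-+ᴹ {n} A B C i j =
    trans (sumFin-cong (λ k → *-distribˡ-+ (A i k) (B k j) (C k j))) (sumFin-distrib-+ {n} _ _)

  +ᴹ-·-+ᴹ : ∀ {n} (A B C D : Matrix n) i j →
    ((A +ᴹ B) · (C +ᴹ D)) i j ≡ ((A · C) i j + (A · D) i j) + ((B · C) i j + (B · D) i j)
  +ᴹ-·-+ᴹ A B C D i j =
    trans (·-distribʳ-+ᴹ A B (C +ᴹ D) i j)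
          (cong₂ _+_ (·-distribˡ-+ᴹ A C D i j) (·-distribˡ-+ᴹ B C D i j))

  ·ᵀ-comm : ∀ {n} (A B : Matrix n) i j → (A · transpose B) i j ≡ (B · transpose A) j i
  ·ᵀ-comm A B i j = sumFin-cong (λ k → *-comm (A i k) (B j k))

  I·ᵀ : ∀ {n} (A : Matrix n) i j → (I n · transpose A) i j ≡ A j i
  I·ᵀ A i j = sumFin-δˡ i (A j)

  ·ᵀI : ∀ {n} (A : Matrix n) i j → (A · transpose (I n)) i j ≡ A i j
  ·ᵀI A i j = trans (·ᵀ-comm A (I _) i j) (I·ᵀ A j i)

  J·ᵀJ : ∀ n i j → (J n · transpose (J n)) i j ≡ + n
  J·ᵀJ n i j = trans (sumFin-const n 1ℤ) (*-identityʳ (+ n))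

  ⊗-combine : ∀ {m n} (A : Matrix m) (B : Matrix n) a b x y →
    (A ⊗ B) (combine a x) (combine b y) ≡ A a b * B x y
  ⊗-combine {m} {n} A B a b x y =
    cong₂ (λ p p′ → A (proj₁ p) (proj₁ p′) * B (proj₂ p) (proj₂ p′))
          (remQuot-combine {m} {n} a x) (remQuot-combine {m} {n} b y)

  ⊗-·-⊗ : ∀ {m n} (A C : Matrix m) (B D : Matrix n) a b x y →
    ((A ⊗ B) · (C ⊗ D)) (combine a x) (combine b y) ≡ (A · C) a b * (B · D) x y
  ⊗-·-⊗ {m} {n} A C B D a b x y = begin
    ((A ⊗ B) · (C ⊗ D)) (combine a x) (combine b y)
      ≡⟨ sumFin-combine {m} {n} (λ r → (A ⊗ B) (combine a x) r * (C ⊗ D) r (combine b y)) ⟩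
    sumFin {m} (λ c → sumFin {n} (λ z → (A ⊗ B) (combine a x) (combine c z) * (C ⊗ D) (combine c z) (combine b y)))
      ≡⟨ sumFin-cong (λ c → sumFin-cong (λ z →
           cong₂ _*_ (⊗-combine A B a c x z) (⊗-combine C D c b z y))) ⟩
    sumFin {m} (λ c → sumFin {n} (λ z → (A a c * B x z) * (C c b * D z y)))
      ≡⟨ sumFin-cong (λ c → sumFin-cong (λ z → interchange (A a c) (B x z) (C c b) (D z y))) ⟩
    sumFin {m} (λ c → sumFin {n} (λ z → (A a c * C c b) * (B x z * D z y)))
      ≡⟨ sumFin-cong (λ c → sumFin-*ˡ {n} (A a c * C c b) (λ z → B x z * D z y)) ⟩
    sumFin {m} (λ c → (A a c * C c b) * (B · D) x y)
      ≡⟨ sumFin-*ʳ {m} (λ c → A a c * C c b) ((B · D) x y) ⟩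
    (A · C) a b * (B · D) x y ∎
    where
    interchange : ∀ p q r s → (p * q) * (r * s) ≡ (p * r) * (q * s)
    interchange = solve-∀

  combine-ext : ∀ {m n} {M N : Matrix (m ℕ.* n)} →
    (∀ a x b y → M (combine a x) (combine b y) ≡ N (combine a x) (combine b y)) →
    ∀ k l → M k l ≡ N k l
  combine-ext {m} {n} M≗N k l with combine-surjective {m} {n} k | combine-surjective {m} {n} l
  ... | a , x , refl | b , y , refl = M≗N a x b y

  transpose-skew : ∀ {n} {A : Matrix n} → IsSkewSymmetric A → IsSkewSymmetric (transpose A)
  transpose-skew {A = A} skew i j = trans (sym (neg-involutive (A i j))) (cong -_ (sym (skew i j)))

  skew-ᵀ· : ∀ {n} {A : Matrix n} → IsSkewSymmetric A → ∀ i j → (transpose A · A) i j ≡ (A · transpose A) i j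
  skew-ᵀ· {A = A} skew i j =
    sumFin-cong (λ k → trans (cong₂ _*_ (skew i k) (skew j k)) (neg-*-neg (A i k) (A j k)))
    where
    neg-*-neg : ∀ a b → - a * - b ≡ a * b
    neg-*-neg = solve-∀

  PM1-* : ∀ {a b} → PM1 a → PM1 b → PM1 (a * b)
  PM1-* (inj₁ refl) (inj₁ refl) = inj₁ refl
  PM1-* (inj₁ refl) (inj₂ refl) = inj₂ refl
  PM1-* (inj₂ refl) (inj₁ refl) = inj₂ refl
  PM1-* (inj₂ refl) (inj₂ refl) = inj₁ refl

  4∤2 : ¬ (4 ℕ.∣ 2)
  4∤2 4∣2 with ℕ.∣⇒≤ 4∣2
  ... | ℕ.s≤s (ℕ.s≤s ())

  PM1-+-∣4 : ∀ {u v} → PM1 u → PM1 v → + 4 ∣ u + v → v ≡ - u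
  PM1-+-∣4 (inj₁ refl) (inj₁ refl) 4∣u+v = ⊥-elim (4∤2 (∣⇒∣ᵤ 4∣u+v))
  PM1-+-∣4 (inj₁ refl) (inj₂ refl) 4∣u+v = refl
  PM1-+-∣4 (inj₂ refl) (inj₁ refl) 4∣u+v = refl
  PM1-+-∣4 (inj₂ refl) (inj₂ refl) 4∣u+v = ⊥-elim (4∤2 (∣⇒∣ᵤ 4∣u+v))

  PM1-4∣[1+u][1+v] : ∀ {u v} → PM1 u → PM1 v → + 4 ∣ (1ℤ + u) * (1ℤ + v)
  PM1-4∣[1+u][1+v] (inj₁ refl) (inj₁ refl) = divides 1ℤ refl
  PM1-4∣[1+u][1+v] (inj₁ refl) (inj₂ refl) = divides 0ℤ refl
  PM1-4∣[1+u][1+v] (inj₂ refl) (inj₁ refl) = divides 0ℤ refl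
  PM1-4∣[1+u][1+v] (inj₂ refl) (inj₂ refl) = divides 0ℤ refl

  n%4≡3⇒4∣n-3 : ∀ n → n % 4 ≡ 3 → + 4 ∣ + n - + 3
  n%4≡3⇒4∣n-3 n n%4≡3 = divides (+ (n / 4)) (begin
    + n - + 3                       ≡⟨ cong (λ t → + t - + 3) (m≡m%n+[m/n]*n n 4) ⟩
    + (n % 4 ℕ.+ n / 4 ℕ.* 4) - + 3 ≡⟨ cong (λ r → + (r ℕ.+ n / 4 ℕ.* 4) - + 3) n%4≡3 ⟩
    + (3 ℕ.+ n / 4 ℕ.* 4) - + 3     ≡⟨ cong (_- + 3) (trans (pos-+ 3 _) (cong (λ t → + 3 + t) (pos-* (n / 4) 4))) ⟩
    + 3 + + (n / 4) * + 4 - + 3     ≡⟨ cancel (+ (n / 4) * + 4) ⟩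
    + (n / 4) * + 4                 ∎)
    where
    cancel : ∀ t → + 3 + t - + 3 ≡ t
    cancel = solve-∀

  conference-[J+C][J+C]ᵀ : ∀ {q} {C : Matrix q} → IsConference q C → ∀ {i j} → i ≢ j →
    ((J q +ᴹ C) · transpose (J q +ᴹ C)) i j ≡ + q - 1ℤ
  conference-[J+C][J+C]ᵀ {q} {C} (_ , _ , CCᵀ , CJ , _) {i} {j} i≢j = begin
    ((J q +ᴹ C) · transpose (J q +ᴹ C)) i j
      ≡⟨ +ᴹ-·-+ᴹ (J q) C (J q) (transpose C) i j ⟩
    ((J q · J q) i j + (J q · transpose C) i j) + ((C · J q) i j + (C · transpose C) i j)
      ≡⟨ cong₂ _+_ (cong₂ _+_ (J·ᵀJ q i j) (trans (·ᵀ-comm (J q) C i j) (CJ j i)))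
                   (cong₂ _+_ (CJ i j) (trans (CCᵀ i j) (cong (λ d → + q * d - 1ℤ) (δ-≢ i≢j)))) ⟩
    (+ q + 0ℤ) + (0ℤ + (+ q * 0ℤ - 1ℤ))
      ≡⟨ simplify (+ q) ⟩
    + q - 1ℤ ∎
    where
    simplify : ∀ Q → (Q + 0ℤ) + (0ℤ + (Q * 0ℤ - 1ℤ)) ≡ Q - 1ℤ
    simplify = solve-∀

  conference-4∣C+Cᵀ : ∀ {q} {C : Matrix q} → q % 4 ≡ 3 → IsConference q C → ∀ {i j} → i ≢ j →
    + 4 ∣ C i j + C j i
  conference-4∣C+Cᵀ {q} {C} q%4≡3 C-conf@(diag , off , _) {i} {j} i≢j =
    subst (+ 4 ∣_) (isolate (+ q) (C i j) (C j i)) (∣m∣n⇒∣m-n (n%4≡3⇒4∣n-3 q q%4≡3) 4∣q-1-Fji-Fij)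
    where
    F : Matrix q
    F = J q +ᴹ C

    diagonal-terms : Fin q → ℤ
    diagonal-terms k = δ i k * F j k + δ j k * F i k

    sum-diagonal-terms : sumFin diagonal-terms ≡ F j i + F i j
    sum-diagonal-terms =
      trans (sumFin-distrib-+ {q} _ _) (cong₂ _+_ (sumFin-δˡ i (F j)) (sumFin-δˡ j (F i)))

    4∣off-diagonal : ∀ k → + 4 ∣ F i k * F j k - diagonal-terms k
    4∣off-diagonal k with k ≟ i | k ≟ j
    ... | yes refl | yes refl = ⊥-elim (i≢j refl)
    ... | yes refl | no k≢j rewrite δ-refl k | δ-≢ (λ j≡k → k≢j (sym j≡k)) | diag k =
      divides 0ℤ (vanish (C j k) (1ℤ + 0ℤ))
      where
      vanish : ∀ c d → (1ℤ + 0ℤ) * (1ℤ + c) - (1ℤ * (1ℤ + c) + 0ℤ * d) ≡ 0ℤ * + 4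
      vanish = solve-∀
    ... | no k≢i   | yes refl rewrite δ-refl k | δ-≢ (λ i≡k → k≢i (sym i≡k)) | diag k =
      divides 0ℤ (vanish (C i k) (1ℤ + 0ℤ))
      where
      vanish : ∀ c d → (1ℤ + c) * (1ℤ + 0ℤ) - (0ℤ * d + 1ℤ * (1ℤ + c)) ≡ 0ℤ * + 4
      vanish = solve-∀
    ... | no k≢i   | no k≢j rewrite δ-≢ (λ i≡k → k≢i (sym i≡k)) | δ-≢ (λ j≡k → k≢j (sym j≡k)) =
      subst (+ 4 ∣_) (sym (+-identityʳ _))
            (PM1-4∣[1+u][1+v] (off i k (λ i≡k → k≢i (sym i≡k))) (off j k (λ j≡k → k≢j (sym j≡k))))

    4∣q-1-Fji-Fij : + 4 ∣ (+ q - 1ℤ) - (F j i + F i j)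
    4∣q-1-Fji-Fij = subst₂ (λ a b → + 4 ∣ a - b) (conference-[J+C][J+C]ᵀ C-conf i≢j) sum-diagonal-terms
                           (sumFin-congruent (λ k → F i k * F j k) diagonal-terms 4∣off-diagonal)

    isolate : ∀ Q c c′ → (Q - + 3) - ((Q - 1ℤ) - ((1ℤ + c′) + (1ℤ + c))) ≡ c + c′
    isolate = solve-∀

  conference-skew : ∀ {q} {C : Matrix q} → q % 4 ≡ 3 → IsConference q C → IsSkewSymmetric C
  conference-skew q%4≡3 C-conf@(diag , off , _) i j with i ≟ j
  ... | yes refl rewrite diag i = refl
  ... | no i≢j   =
    PM1-+-∣4 (off i j i≢j) (off j i (λ j≡i → i≢j (sym j≡i))) (conference-4∣C+Cᵀ q%4≡3 C-conf i≢j)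

  transpose-conference : ∀ {q} {C : Matrix q} → IsSkewSymmetric C → IsConference q C →
    IsConference q (transpose C)
  transpose-conference {q} {C} skew (diag , off , CCᵀ , CJ , JC) =
    diag ,
    (λ i j i≢j → off j i (λ j≡i → i≢j (sym j≡i))) ,
    (λ i j → trans (skew-ᵀ· skew i j) (CCᵀ i j)) ,
    (λ i j → trans (·ᵀ-comm (transpose C) (J q) i j) (JC j i)) ,
    (λ i j → trans (·ᵀ-comm (J q) C i j) (CJ j i))

  IsHollowSign : ∀ {n} → Matrix n → Set
  IsHollowSign A = (∀ i → A i i ≡ 0ℤ) × (∀ i j → i ≢ j → PM1 (A i j))

  I+hollowSign-PM1 : ∀ {q} {C : Matrix q} → IsHollowSign C → ∀ a b → PM1 ((I q +ᴹ C) a b)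
  I+hollowSign-PM1 {C = C} (diag , off) a b with a ≟ b
  ... | yes refl rewrite δ-refl a | diag a = inj₁ refl
  ... | no a≢b   rewrite δ-≢ a≢b = subst PM1 (sym (+-identityˡ (C a b))) (off a b a≢b)

  IsSkewWeighing : ∀ m → ℕ → Matrix m → Set
  IsSkewWeighing m q Z =
    IsSkewSymmetric Z × (∀ x y → (Z · transpose Z) x y ≡ scalarI m (+ q) x y)

  transpose-skewWeighing : ∀ {m q} {Z : Matrix m} → IsSkewWeighing m q Z → IsSkewWeighing m q (transpose Z)
  transpose-skewWeighing (skew , ZZᵀ) = transpose-skew skew , λ x y → trans (skew-ᵀ· skew x y) (ZZᵀ x y)

  border : ∀ {q} → Matrix q → Matrix (suc q)
  border C zero    zero    = 0ℤ
  border C zero    (suc j) = 1ℤ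
  border C (suc i) zero    = -1ℤ
  border C (suc i) (suc j) = C i j

  border-hollowSign : ∀ {q} {C : Matrix q} → IsHollowSign C → IsHollowSign (border C)
  border-hollowSign {C = C} (diag , off) = border-diag , border-off
    where
    border-diag : ∀ x → border C x x ≡ 0ℤ
    border-diag zero    = refl
    border-diag (suc i) = diag i

    border-off : ∀ x y → x ≢ y → PM1 (border C x y)
    border-off zero    zero    x≢y = ⊥-elim (x≢y refl)
    border-off zero    (suc j) x≢y = inj₁ refl
    border-off (suc i) zero    x≢y = inj₂ refl
    border-off (suc i) (suc j) x≢y = off i j (λ i≡j → x≢y (cong suc i≡j))

  border-skewWeighing : ∀ {q} {C : Matrix q} → IsSkewSymmetric C → IsConference q C →
    IsSkewWeighing (suc q) q (border C)
  border-skewWeighing {q} {C} C-skew (_ , _ , CCᵀ , CJ , _) = border-skew , border-·ᵀ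
    where
    border-skew : IsSkewSymmetric (border C)
    border-skew zero    zero    = refl
    border-skew zero    (suc j) = refl
    border-skew (suc i) zero    = refl
    border-skew (suc i) (suc j) = C-skew i j

    border-·ᵀ : ∀ x y → (border C · transpose (border C)) x y ≡ scalarI (suc q) (+ q) x y
    border-·ᵀ zero    zero    = trans (+-identityˡ _) (sumFin-const q 1ℤ)
    border-·ᵀ zero    (suc j) = begin
      0ℤ + sumFin (λ k → 1ℤ * C j k) ≡⟨ +-identityˡ _ ⟩
      sumFin (λ k → 1ℤ * C j k)      ≡⟨ sumFin-cong (λ k → *-comm 1ℤ (C j k)) ⟩
      (C · J q) j j                  ≡⟨ CJ j j ⟩
      0ℤ                             ≡⟨ *-zeroʳ (+ q) ⟨
      + q * 0ℤ                       ∎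
    border-·ᵀ (suc i) zero    = trans (+-identityˡ _) (trans (CJ i i) (sym (*-zeroʳ (+ q))))
    border-·ᵀ (suc i) (suc j) = trans (cong (λ t → 1ℤ + t) (CCᵀ i j)) (cancel (+ q * δ i j))
      where
      cancel : ∀ t → 1ℤ + (t - 1ℤ) ≡ t
      cancel = solve-∀

  conference-[I+C]Jᵀ : ∀ {q} {C : Matrix q} → IsConference q C → ∀ a b →
    ((I q +ᴹ C) · transpose (J q)) a b ≡ 1ℤ
  conference-[I+C]Jᵀ {q} {C} (_ , _ , _ , CJ , _) a b =
    trans (·-distribʳ-+ᴹ (I q) C (J q) a b) (cong₂ _+_ (I·ᵀ (J q) a b) (CJ a b))

  skewConference-[I+C][I+C]ᵀ : ∀ {q} {C : Matrix q} → IsSkewSymmetric C → IsConference q C → ∀ a b →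
    ((I q +ᴹ C) · transpose (I q +ᴹ C)) a b ≡ + suc q * δ a b - 1ℤ
  skewConference-[I+C][I+C]ᵀ {q} {C} C-skew (_ , _ , CCᵀ , _) a b = begin
    ((I q +ᴹ C) · transpose (I q +ᴹ C)) a b
      ≡⟨ +ᴹ-·-+ᴹ (I q) C (transpose (I q)) (transpose C) a b ⟩
    ((I q · transpose (I q)) a b + (I q · transpose C) a b) + ((C · transpose (I q)) a b + (C · transpose C) a b)
      ≡⟨ cong₂ _+_ (cong₂ _+_ (I·ᵀ (I q) a b) (I·ᵀ C a b)) (cong₂ _+_ (·ᵀI C a b) (CCᵀ a b)) ⟩
    (δ b a + C b a) + (C a b + (+ q * δ a b - 1ℤ))
      ≡⟨ cong₂ (λ d c → (d + c) + (C a b + (+ q * δ a b - 1ℤ))) (δ-sym b a) (C-skew a b) ⟩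
    (δ a b + - C a b) + (C a b + (+ q * δ a b - 1ℤ))
      ≡⟨ collect (δ a b) (C a b) (+ q) ⟩
    (1ℤ + + q) * δ a b - 1ℤ
      ≡⟨ cong (λ t → t * δ a b - 1ℤ) (sym (pos-+ 1 q)) ⟩
    + suc q * δ a b - 1ℤ ∎
    where
    collect : ∀ d c Q → (d + - c) + (c + (Q * d - 1ℤ)) ≡ (1ℤ + Q) * d - 1ℤ
    collect = solve-∀

  conferenceProduct : ∀ {q m} → Matrix q → Matrix m → Matrix (q ℕ.* m)
  conferenceProduct {q} {m} C Z = J q ⊗ I m +ᴹ (I q +ᴹ C) ⊗ Z

  conferenceProduct-·ᵀ : ∀ {q m} {C : Matrix q} {Z : Matrix m} →
    IsSkewSymmetric C → IsConference q C → IsSkewWeighing m q Z →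
    let P = conferenceProduct C Z in
    ∀ k l → (P · transpose P) k l ≡ scalarI (q ℕ.* m) (+ (q ℕ.* suc q)) k l
  conferenceProduct-·ᵀ {q} {m} {C} {Z} C-skew C-conf (Z-skew , ZZᵀ) = combine-ext {q} {m} entry
    where
    E : Matrix q
    E = I q +ᴹ C

    entry : ∀ a x b y → (conferenceProduct C Z · transpose (conferenceProduct C Z)) (combine a x) (combine b y)
                       ≡ scalarI (q ℕ.* m) (+ (q ℕ.* suc q)) (combine a x) (combine b y)
    entry a x b y = begin
      (conferenceProduct C Z · transpose (conferenceProduct C Z)) (combine a x) (combine b y)
        -- transpose (A ⊗ B) is definitionally transpose A ⊗ transpose B
        ≡⟨ +ᴹ-·-+ᴹ (J q ⊗ I m) (E ⊗ Z) (transpose (J q) ⊗ transpose (I m)) (transpose E ⊗ transpose Z)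
                   (combine a x) (combine b y) ⟩
      _ ≡⟨ cong₂ _+_ (cong₂ _+_ (⊗-·-⊗ (J q) (transpose (J q)) (I m) (transpose (I m)) a b x y)
                                (⊗-·-⊗ (J q) (transpose E) (I m) (transpose Z) a b x y))
                     (cong₂ _+_ (⊗-·-⊗ E (transpose (J q)) Z (transpose (I m)) a b x y)
                                (⊗-·-⊗ E (transpose E) Z (transpose Z) a b x y)) ⟩
      ((J q · transpose (J q)) a b * (I m · transpose (I m)) x y + (J q · transpose E) a b * (I m · transpose Z) x y)
        + ((E · transpose (J q)) a b * (Z · transpose (I m)) x y + (E · transpose E) a b * (Z · transpose Z) x y)
        ≡⟨ cong₂ _+_ (cong₂ _+_ (cong₂ _*_ (J·ᵀJ q a b) (IIᵀ x y)) (cong₂ _*_ (JEᵀ a b) (IZᵀ x y)))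
                     (cong₂ _+_ (cong₂ _*_ (conference-[I+C]Jᵀ C-conf a b) (·ᵀI Z x y))
                                (cong₂ _*_ (skewConference-[I+C][I+C]ᵀ C-skew C-conf a b) (ZZᵀ x y))) ⟩
      (+ q * δ x y + 1ℤ * - Z x y) + (1ℤ * Z x y + (+ suc q * δ a b - 1ℤ) * (+ q * δ x y))
        ≡⟨ collect (+ q) (+ suc q) (δ a b) (δ x y) (Z x y) ⟩
      (+ q * + suc q) * (δ a b * δ x y)
        ≡⟨ cong₂ _*_ (sym (pos-* q (suc q))) (sym (δ-combine a b x y)) ⟩
      + (q ℕ.* suc q) * δ (combine a x) (combine b y) ∎
      where
      IIᵀ : ∀ x y → (I m · transpose (I m)) x y ≡ δ x y
      IIᵀ x y = trans (I·ᵀ (I m) x y) (δ-sym y x)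

      JEᵀ : ∀ a b → (J q · transpose E) a b ≡ 1ℤ
      JEᵀ a b = trans (·ᵀ-comm (J q) E a b) (conference-[I+C]Jᵀ C-conf b a)

      IZᵀ : ∀ x y → (I m · transpose Z) x y ≡ - Z x y
      IZᵀ x y = trans (I·ᵀ Z x y) (Z-skew x y)

      collect : ∀ Q Q′ d e z → (Q * e + 1ℤ * - z) + (1ℤ * z + (Q′ * d - 1ℤ) * (Q * e)) ≡ (Q * Q′) * (d * e)
      collect = solve-∀

  conferenceProduct-transpose : ∀ {q m} (C : Matrix q) (Z : Matrix m) k l →
    transpose (conferenceProduct C Z) k l ≡ conferenceProduct (transpose C) (transpose Z) k l
  conferenceProduct-transpose {q} {m} C Z = combine-ext {q} {m} entry
    where
    entry : ∀ a x b y → conferenceProduct C Z (combine b y) (combine a x)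
                       ≡ conferenceProduct (transpose C) (transpose Z) (combine a x) (combine b y)
    entry a x b y = begin
      conferenceProduct C Z (combine b y) (combine a x)
        ≡⟨ cong₂ _+_ (⊗-combine (J q) (I m) b a y x) (⊗-combine (I q +ᴹ C) Z b a y x) ⟩
      1ℤ * δ y x + (δ b a + C b a) * Z y x
        ≡⟨ cong₂ (λ d e → 1ℤ * d + (e + C b a) * Z y x) (δ-sym y x) (δ-sym b a) ⟩
      1ℤ * δ x y + (δ a b + C b a) * Z y x
        ≡⟨ sym (cong₂ _+_ (⊗-combine (J q) (I m) a b x y) (⊗-combine (I q +ᴹ transpose C) (transpose Z) a b x y)) ⟩
      conferenceProduct (transpose C) (transpose Z) (combine a x) (combine b y) ∎

  conferenceProduct-ᵀ· : ∀ {q m} {C : Matrix q} {Z : Matrix m} →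
    IsSkewSymmetric C → IsConference q C → IsSkewWeighing m q Z →
    let P = conferenceProduct C Z in
    ∀ k l → (transpose P · P) k l ≡ scalarI (q ℕ.* m) (+ (q ℕ.* suc q)) k l
  conferenceProduct-ᵀ· {q} {C = C} {Z} C-skew C-conf Z-weighing k l =
    trans (·-cong (conferenceProduct-transpose C Z) (λ i j → conferenceProduct-transpose C Z j i) k l)
          (conferenceProduct-·ᵀ (transpose-skew C-skew) (transpose-conference C-skew C-conf)
                                (transpose-skewWeighing {q = q} Z-weighing) k l)

  conferenceProduct-PM1 : ∀ {q m} {C : Matrix q} {Z : Matrix m} → IsHollowSign C → IsHollowSign Z →
    ∀ k l → PM1 (conferenceProduct C Z k l)
  conferenceProduct-PM1 {q} {m} {C} {Z} C-hollow (Z-diag , Z-off) k l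
    with combine-surjective {q} {m} k | combine-surjective {q} {m} l
  ... | a , x , refl | b , y , refl
    rewrite ⊗-combine (J q) (I m) a b x y | ⊗-combine (I q +ᴹ C) Z a b x y with x ≟ y
  ... | yes refl rewrite δ-refl x | Z-diag x | *-zeroʳ (δ a b + C a b) = inj₁ refl
  ... | no x≢y   rewrite δ-≢ x≢y =
    subst PM1 (sym (+-identityˡ _)) (PM1-* (I+hollowSign-PM1 C-hollow a b) (Z-off x y x≢y))

  conferenceProduct-isHadamard : ∀ {q} {C : Matrix q} → IsSkewSymmetric C → IsConference q C →
    IsHadamard (q ℕ.* suc q) (conferenceProduct C (border C))
  conferenceProduct-isHadamard {q} {C} C-skew C-conf@(diag , off , _) =
    conferenceProduct-PM1 (diag , off) (border-hollowSign (diag , off)) ,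
    conferenceProduct-·ᵀ C-skew C-conf Z-weighing ,
    conferenceProduct-ᵀ· C-skew C-conf Z-weighing
    where
    Z-weighing : IsSkewWeighing (suc q) q (border C)
    Z-weighing = border-skewWeighing C-skew C-conf

open import Data.Nat using (ℕ; suc; _+_; _*_; _<_; _%_; _/_)
open import Data.Nat.DivMod using (m≡m%n+[m/n]*n; [m+kn]%n≡m%n)
open import Data.Nat.Tactic.RingSolver using (solve-∀)
open import Data.Product using (Σ; _,_)
open import Relation.Binary.PropositionalEquality using (_≡_; cong; trans; subst)

theorem3p2 : (s q : ℕ) → 0 < s → 0 < q → q ≡ 2 * s + 1 → s % 4 ≡ 3 →
    Σ (Matrix (s + 1)) (IsSkewHadamard (s + 1)) →
    Σ (Matrix q) (IsConference q) →
    Σ (Matrix (2 * q * (s + 1))) (IsHadamard (2 * q * (s + 1)))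
theorem3p2 s q _ _ q≡2s+1 s%4≡3 _ (C , C-conf) =
  subst (λ n → Σ (Matrix n) (IsHadamard n)) order
        (conferenceProduct C (border C) , conferenceProduct-isHadamard (conference-skew q%4≡3 C-conf) C-conf)
  where
  q≡3+[2t+1]*4 : q ≡ 3 + (2 * (s / 4) + 1) * 4
  q≡3+[2t+1]*4 = trans q≡2s+1 (trans (cong (λ n → 2 * n + 1) s≡3+t*4) (regroup (s / 4)))
    where
    s≡3+t*4 : s ≡ 3 + s / 4 * 4
    s≡3+t*4 = trans (m≡m%n+[m/n]*n s 4) (cong (λ r → r + s / 4 * 4) s%4≡3)

    regroup : ∀ t → 2 * (3 + t * 4) + 1 ≡ 3 + (2 * t + 1) * 4
    regroup = solve-∀

  q%4≡3 : q % 4 ≡ 3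
  q%4≡3 = trans (cong (_% 4) q≡3+[2t+1]*4) ([m+kn]%n≡m%n 3 (2 * (s / 4) + 1) 4)

  order : q * suc q ≡ 2 * q * (s + 1)
  order = trans (cong (λ n → q * suc n) q≡2s+1) (regroup q s)
    where
    regroup : ∀ q s → q * suc (2 * s + 1) ≡ 2 * q * (s + 1)
    regroup = solve-∀
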